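{- Let $G=(X,<\!\!>,\sqsubset)$ be a gso-structure, $\prec_G=<\!\!>\cap\sqsubset$, and $\lhd\in ext(G)$. Then (1) $(\lhd\setminus ser_G)^{\mathrm{sym}}\cup inl_G=<\!\!>=<\!\!>\setminus ser_G^{\mathrm{sym}}$; (2) $\lhd^\frown\setminus(ser_G^{ -1}\cup inl_G)=\sqsubset=\sqsubset\setminus(ser_G^{ -1}\cup inl_G)$; (3) $G^{\{\lhd\}}=(X,<\!\!>,\sqsubset)$; (4) $\prec_G=\lhd\setminus(ser_G\cup inl_G)$; (5) $<\!\!>=\prec_G^{\mathrm{sym}}\cup inl_G$.
   Context: $R^{\mathrm{sym}}=R\cup R^{ -1}$. An so-structure is $(X,\prec,\sqsubset)$ with, for all $a,b,c$: $\neg(a\sqsubset a)$; $a\prec b\Rightarrow a\sqsubset b$; $a\sqsubset b\sqsubset c\wedge a\ne c\Rightarrow a\sqsubset c$; $(a\sqsubset b\prec c\vee a\prec b\sqsubset c)\Rightarrow a\prec c$. A gso-structure is $(X,<\!\!>,\sqsubset)$ with $\sqsubset$ irreflexive, $<\!\!>$ symmetric and irreflexive, and $(X,<\!\!>\cap\sqsubset,\sqsubset)$ an so-structure. A stratified order on $X$ is an irreflexive transitive $\lhd$ for which $a\simeq b\iff(a=b\vee(\neg a\lhd b\wedge\neg b\lhd a))$ is an equivalence; $a\lhd^\frown b$ iff $a\ne b\wedge\neg(b\lhd a)$. $ext(G)$ is the set of stratified orders $\lhd$ on $X$ with $a<\!\!>b\Rightarrow(a\lhd b\vee b\lhd a)$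 and $a\sqsubset b\Rightarrow a\lhd^\frown b$. For distinct $a,b\in X$: $(a,b)\in ser_G$ iff $\neg(a<\!\!>b)\wedge\neg(b\sqsubset a)$; $(a,b)\in inl_G$ iff $a<\!\!>b\wedge\neg(a\sqsubset b\vee b\sqsubset a)$. $G^{\{\lhd\}}=\big(X,(\lhd\setminus ser_G)^{\mathrm{sym}}\cup inl_G,\ \lhd^\frown\setminus(ser_G^{ -1}\cup inl_G)\big)$. -}

module Defs where

open import Level using (0ℓ)
open import Data.Product using (_×_; _,_)
open import Data.Sum using (_⊎_)
open import Relation.Nullary using (¬_)
open import Relation.Binary.PropositionalEquality using (_≡_; _≢_)

BRel : Set → Set₁
BRel X = X → X → Set

module _ {X : Set} where

  _∪ʳ_ : BRel X → BRel X → BRel X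
  (R ∪ʳ S) a b = R a b ⊎ S a b

  _∩ʳ_ : BRel X → BRel X → BRel X
  (R ∩ʳ S) a b = R a b × S a b

  _∖ʳ_ : BRel X → BRel X → BRel X
  (R ∖ʳ S) a b = R a b × ¬ S a b

  _⁻¹ʳ : BRel X → BRel X
  (R ⁻¹ʳ) a b = R b a

  symʳ : BRel X → BRel X
  symʳ R = R ∪ʳ (R ⁻¹ʳ)

  _≐_ : BRel X → BRel X → Set
  R ≐ S = ∀ a b → (R a b → S a b) × (S a b → R a b)

  record IsSO (≺ ⊏ : BRel X) : Set where
    field
      ⊏-irrefl : ∀ a → ¬ ⊏ a a
      ≺⇒⊏      : ∀ a b → ≺ a b → ⊏ a b
      ⊏-trans  : ∀ a b c → ⊏ a b → ⊏ b c → a ≢ c → ⊏ a c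
      mixed    : ∀ a b c → (⊏ a b × ≺ b c) ⊎ (≺ a b × ⊏ b c) → ≺ a c

  record IsGSO (<> ⊏ : BRel X) : Set where
    field
      ⊏-irrefl  : ∀ a → ¬ ⊏ a a
      <>-sym    : ∀ a b → <> a b → <> b a
      <>-irrefl : ∀ a → ¬ <> a a
      so        : IsSO (<> ∩ʳ ⊏) ⊏

  incomp : BRel X → BRel X
  incomp ◁ a b = a ≡ b ⊎ (¬ ◁ a b × ¬ ◁ b a)

  record IsStratified (◁ : BRel X) : Set where
    field
      irrefl     : ∀ a → ¬ ◁ a a
      trans      : ∀ a b c → ◁ a b → ◁ b c → ◁ a c
      ≃-refl     : ∀ a → incomp ◁ a a
      ≃-sym      : ∀ a b → incomp ◁ a b → incomp ◁ b a
      ≃-trans    : ∀ a b c → incomp ◁ a b → incomp ◁ b c → incomp ◁ a c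

  _⌢ : BRel X → BRel X
  (◁ ⌢) a b = a ≢ b × ¬ ◁ b a

  record InExt (<> ⊏ ◁ : BRel X) : Set where
    field
      stratified : IsStratified ◁
      <>⇒◁      : ∀ a b → <> a b → ◁ a b ⊎ ◁ b a
      ⊏⇒◁⌢      : ∀ a b → ⊏ a b → (◁ ⌢) a b

  ser : BRel X → BRel X → BRel X
  ser <> ⊏ a b = a ≢ b × ¬ <> a b × ¬ ⊏ b a

  inl : BRel X → BRel X → BRel X
  inl <> ⊏ a b = a ≢ b × <> a b × ¬ (⊏ a b ⊎ ⊏ b a)

  precG : BRel X → BRel X → BRel X
  precG <> ⊏ = <> ∩ʳ ⊏

  extInter : BRel X → BRel X → BRel X → BRel X
  extInter <> ⊏ ◁ = symʳ (◁ ∖ʳ ser <> ⊏) ∪ʳ inl <> ⊏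

  extSub : BRel X → BRel X → BRel X → BRel X
  extSub <> ⊏ ◁ = (◁ ⌢) ∖ʳ ((ser <> ⊏ ⁻¹ʳ) ∪ʳ inl <> ⊏)

  -- G^{◁} as a pair (interleaving relation, weak causality relation)
  G^ : BRel X → BRel X → BRel X → BRel X × BRel X
  G^ <> ⊏ ◁ = extInter <> ⊏ ◁ , extSub <> ⊏ ◁

  _≐²_ : BRel X × BRel X → BRel X × BRel X → Set
  (R , S) ≐² (R' , S') = (R ≐ R') × (S ≐ S')

module Submission where

-- Of all the axioms of a gso-structure G = (X, <>, ⊏) and of
-- ◁ ∈ ext(G), the five identities only use four facts, bundled below as
-- `Compatible <> ⊏ ◁`:  <> is symmetric, ◁ is irreflexive, ◁ orients every
-- <>-pair, and ⊏ ⊆ ◁⌢.  Working classically (excluded middle decides membership in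
-- the relations), we prove from these four facts:
--   * ◁-pairs that are not serialisable are <>-pairs, and <>-pairs are never
--     serialisable; this gives (1).
--   * ⊏-pairs are never in ser⁻¹ ∪ inl, and conversely a ◁⌢-pair outside
--     ser⁻¹ ∪ inl is a ⊏-pair; this gives (2), and (3) combines (1) and (2).
--   * on a <>-pair, ⊏ forces the ◁-orientation; this gives (4).
--   * every <>-pair is in ≺_G, in ≺_G⁻¹, or in inl_G; this gives (5).

open import Defs
open import Level using (0ℓ)
open import Data.Product using (_×_; _,_; proj₁; proj₂)
open import Data.Sum using (_⊎_; inj₁; inj₂; [_,_])
open import Data.Empty using (⊥-elim)
open import Relation.Nullary using (¬_; yes; no)
open import Relation.Binary.PropositionalEquality using (refl; _≢_; ≢-sym)
open import Axiom.ExcludedMiddle using (ExcludedMiddle)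

record Compatible {X : Set} (<> ⊏ ◁ : BRel X) : Set where
  field
    <>-sym    : ∀ {a b} → <> a b → <> b a
    ◁-irrefl  : ∀ a → ¬ ◁ a a
    <>⇒◁      : ∀ {a b} → <> a b → ◁ a b ⊎ ◁ b a
    ⊏⇒◁⌢      : ∀ {a b} → ⊏ a b → (◁ ⌢) a b

ext⇒compatible : ∀ {X : Set} {<> ⊏ ◁ : BRel X} →
  IsGSO <> ⊏ → InExt <> ⊏ ◁ → Compatible <> ⊏ ◁
ext⇒compatible G E = record
  { <>-sym   = λ {a} {b} → IsGSO.<>-sym G a b
  ; ◁-irrefl = IsStratified.irrefl (InExt.stratified E)
  ; <>⇒◁     = λ {a} {b} → InExt.<>⇒◁ E a b
  ; ⊏⇒◁⌢     = λ {a} {b} → InExt.⊏⇒◁⌢ E a b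
  }

module Exclusions {X : Set} (<> ⊏ : BRel X) where

  ⊏⇒¬ser⁻¹∪inl : ∀ {a b} → ⊏ a b → ¬ ((ser <> ⊏ ⁻¹ʳ) ∪ʳ inl <> ⊏) a b
  ⊏⇒¬ser⁻¹∪inl q (inj₁ (_ , _ , ¬q)) = ¬q q
  ⊏⇒¬ser⁻¹∪inl q (inj₂ (_ , _ , ¬q∪q⁻¹)) = ¬q∪q⁻¹ (inj₁ q)

  <>⇒¬ser : ∀ {a b} → <> a b → ¬ ser <> ⊏ a b
  <>⇒¬ser r (_ , ¬r , _) = ¬r r

module Compatibility (EM : ExcludedMiddle 0ℓ) {X : Set} {<> ⊏ ◁ : BRel X}
  (C : Compatible <> ⊏ ◁) where
  open Compatible C
  open Exclusions <> ⊏

  ◁⇒≢ : ∀ {a b} → ◁ a b → a ≢ b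
  ◁⇒≢ {a} p refl = ◁-irrefl a p

  <>⇒≢ : ∀ {a b} → <> a b → a ≢ b
  <>⇒≢ r refl with <>⇒◁ r
  ... | inj₁ p = ◁⇒≢ p refl
  ... | inj₂ p = ◁⇒≢ p refl

  <>⇒¬ser⁻¹ : ∀ {a b} → <> a b → ¬ (ser <> ⊏ ⁻¹ʳ) a b
  <>⇒¬ser⁻¹ r = <>⇒¬ser (<>-sym r)

  ⊏-orients-◁ : ∀ {a b} → <> a b → ⊏ a b → ◁ a b
  ⊏-orients-◁ r q with <>⇒◁ r
  ... | inj₁ p = p
  ... | inj₂ p = ⊥-elim (proj₂ (⊏⇒◁⌢ q) p)

  -- A ◁-pair that is not serialisable is a <>-pair: otherwise it would be
  -- serialisable, as ⊏ b a is excluded by ⊏ ⊆ ◁⌢.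
  ◁∖ser⇒<> : ∀ {a b} → ◁ a b → ¬ ser <> ⊏ a b → <> a b
  ◁∖ser⇒<> {a} {b} p ¬s with EM {<> a b}
  ... | yes r = r
  ... | no ¬r = ⊥-elim (¬s (◁⇒≢ p , ¬r , λ q → proj₂ (⊏⇒◁⌢ q) p))

  -- If ⊏ a b failed, the pair
  -- would have to be a <>-pair (else it is in ser⁻¹) with ⊏ b a (else it is in
  -- inl); but then ◁ b a, contradicting ◁⌢ a b.
  ◁⌢∖ser⁻¹∪inl⇒⊏ : ∀ {a b} → (◁ ⌢) a b →
    ¬ ((ser <> ⊏ ⁻¹ʳ) ∪ʳ inl <> ⊏) a b → ⊏ a b
  ◁⌢∖ser⁻¹∪inl⇒⊏ {a} {b} (a≢b , ¬◁ba) ¬bad with EM {⊏ a b}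
  ... | yes q = q
  ... | no ¬q with EM {<> b a}
  ...   | no ¬r = ⊥-elim (¬bad (inj₁ (≢-sym a≢b , ¬r , ¬q)))
  ...   | yes r with EM {⊏ b a}
  ...     | no ¬q' = ⊥-elim (¬bad (inj₂ (a≢b , <>-sym r , [ ¬q , ¬q' ])))
  ...     | yes q' = ⊥-elim (¬◁ba (⊏-orients-◁ r q'))

  <>-trichotomy : ∀ {a b} → <> a b →
    (symʳ (precG <> ⊏) ∪ʳ inl <> ⊏) a b
  <>-trichotomy {a} {b} r with EM {⊏ a b} | EM {⊏ b a}
  ... | yes q | _      = inj₁ (inj₁ (r , q))
  ... | no _  | yes q' = inj₁ (inj₂ (<>-sym r , q'))
  ... | no ¬q | no ¬q' = inj₂ (<>⇒≢ r , r , [ ¬q , ¬q' ])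

  extInter≐<> : extInter <> ⊏ ◁ ≐ <>
  extInter≐<> a b = to , from
    where
    to : extInter <> ⊏ ◁ a b → <> a b
    to (inj₁ (inj₁ (p , ¬s))) = ◁∖ser⇒<> p ¬s
    to (inj₁ (inj₂ (p , ¬s))) = <>-sym (◁∖ser⇒<> p ¬s)
    to (inj₂ (_ , r , _))     = r
    from : <> a b → extInter <> ⊏ ◁ a b
    from r with <>⇒◁ r
    ... | inj₁ p = inj₁ (inj₁ (p , <>⇒¬ser r))
    ... | inj₂ p = inj₁ (inj₂ (p , <>⇒¬ser⁻¹ r))

  <>≐<>∖ser : <> ≐ (<> ∖ʳ symʳ (ser <> ⊏))
  <>≐<>∖ser a b = (λ r → r , [ <>⇒¬ser r , <>⇒¬ser⁻¹ r ]) , proj₁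

  extSub≐⊏ : extSub <> ⊏ ◁ ≐ ⊏
  extSub≐⊏ a b = (λ { (p , ¬bad) → ◁⌢∖ser⁻¹∪inl⇒⊏ p ¬bad })
               , (λ q → ⊏⇒◁⌢ q , ⊏⇒¬ser⁻¹∪inl q)

  ⊏≐⊏∖ser⁻¹∪inl : ⊏ ≐ (⊏ ∖ʳ ((ser <> ⊏ ⁻¹ʳ) ∪ʳ inl <> ⊏))
  ⊏≐⊏∖ser⁻¹∪inl a b = (λ q → q , ⊏⇒¬ser⁻¹∪inl q) , proj₁

  precG≐◁∖ser∪inl : precG <> ⊏ ≐ (◁ ∖ʳ (ser <> ⊏ ∪ʳ inl <> ⊏))
  precG≐◁∖ser∪inl a b = to , from
    where
    to : precG <> ⊏ a b → (◁ ∖ʳ (ser <> ⊏ ∪ʳ inl <> ⊏)) a b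
    to (r , q) = ⊏-orients-◁ r q
               , [ <>⇒¬ser r , (λ { (_ , _ , ¬q∪q⁻¹) → ¬q∪q⁻¹ (inj₁ q) }) ]
    from : (◁ ∖ʳ (ser <> ⊏ ∪ʳ inl <> ⊏)) a b → precG <> ⊏ a b
    from (p , ¬bad) with ◁∖ser⇒<> p (λ s → ¬bad (inj₁ s)) | EM {⊏ a b}
    ... | r | yes q = r , q
    ... | r | no ¬q = ⊥-elim (¬bad (inj₂ (◁⇒≢ p , r ,
                        [ ¬q , (λ q' → proj₂ (⊏⇒◁⌢ q') p) ])))

  <>≐precG-sym∪inl : <> ≐ (symʳ (precG <> ⊏) ∪ʳ inl <> ⊏)
  <>≐precG-sym∪inl a b = <>-trichotomy , from
    where
    from : (symʳ (precG <> ⊏) ∪ʳ inl <> ⊏) a b → <> a b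
    from (inj₁ (inj₁ (r , _))) = r
    from (inj₁ (inj₂ (r , _))) = <>-sym r
    from (inj₂ (_ , r , _))    = r

proposition12p3 : ExcludedMiddle 0ℓ →
    (X : Set) (<> ⊏ ◁ : BRel X) →
    IsGSO <> ⊏ → InExt <> ⊏ ◁ →
      ((extInter <> ⊏ ◁ ≐ <>) × (<> ≐ (<> ∖ʳ symʳ (ser <> ⊏))))
    × ((extSub <> ⊏ ◁ ≐ ⊏) × (⊏ ≐ (⊏ ∖ʳ ((ser <> ⊏ ⁻¹ʳ) ∪ʳ inl <> ⊏))))
    × (G^ <> ⊏ ◁ ≐² (<> , ⊏))
    × (precG <> ⊏ ≐ (◁ ∖ʳ (ser <> ⊏ ∪ʳ inl <> ⊏)))
    × (<> ≐ (symʳ (precG <> ⊏) ∪ʳ inl <> ⊏))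
proposition12p3 EM X <> ⊏ ◁ G E =
    (extInter≐<> , <>≐<>∖ser)
  , (extSub≐⊏ , ⊏≐⊏∖ser⁻¹∪inl)
  , (extInter≐<> , extSub≐⊏)
  , precG≐◁∖ser∪inl
  , <>≐precG-sym∪inl
  where open Compatibility EM (ext⇒compatible G E)
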